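{- Let $n \geq 3$ and let $C_n^\rightarrow$ be the directed cycle with vertices $v_1, \dots, v_n$ and arcs $(v_i, v_{i+1})$ for $i = 1, \dots, n-1$ together with $(v_n, v_1)$ (consecutively directed clockwise). Let $m, c \in \mathbb{Z}$ and $f(x) = mx + c$. Then the Khazamula irregularity satisfies $$irr_k(C_n^\rightarrow) = n\left|\tfrac{3}{2}m + c\right|.$$
   Context: Fibonacci numbers: $f_0 = 0$, $f_1 = 1$, $f_{k+1} = f_k + f_{k-1}$. For a vertex $v$ of a simple directed graph, $d(v) = d^+(v) + d^-(v)$. The $\pm$Fibonacci weight of a vertex $v_i$ is $f^\pm_i = -f_{d(v_i)}$ if $d(v_i)$ is odd and $f^\pm_i = f_{d(v_i)}$ if $d(v_i)$ is even. For a vertex $v_i$ with $d^+(v_i) \geq 1$, $d(v_i^h)$ denotes the maximum of $d(v_j)$ over all head vertices $v_j$ of $v_i$ (all $v_j$ with $(v_i,v_j)$ an arc). For a simple directed graph $G^\rightarrow$ on $n \geq 2$ vertices $v_1, \dots, v_n$ and $f(x) = mx + c$ with $m, c \in \mathbb{Z}$, the Khazamula irregularity is $$irr_k(G^\rightarrow) = \sum_{i=1}^{n} \left| \int_{f^\pm_i}^{d(v_i^h)} f(x)\,dx \right|,$$ where the term for a vertex with $d^+(v_i) = 0$ is defined to be $0$. -}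

module Defs where

open import Data.Bool using (Bool; true; false; if_then_else_; _∨_; _∧_)
import Data.Nat as N
open N using (ℕ; zero; suc; _⊔_)
open import Data.Nat.Properties using (_≟_)
open import Data.Integer as Z using (ℤ; +_)
open import Data.Fin using (Fin; toℕ)
open import Data.List using (List; foldr; map; allFin)
open import Data.Rational using (ℚ; 0ℚ; _+_; _-_; _*_; _/_)
open import Relation.Nullary.Decidable using (⌊_⌋)
open import Relation.Binary.PropositionalEquality using (_≡_)

fib : ℕ → ℕ
fib 0 = 0
fib 1 = 1
fib (suc (suc k)) = fib (suc k) N.+ fib k

-- A directed graph on vertex set Fin n, given by its (Boolean) arc relation:
-- arc i j = true  iff  (v_i , v_j) is an arc.
Digraph : ℕ → Set
Digraph n = Fin n → Fin n → Bool

-- Simple: no loops (multiple arcs are impossible in this representation).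
Simple : ∀ {n} → Digraph n → Set
Simple {n} G = ∀ (i : Fin n) → G i i ≡ false


sumℕ : ∀ {n} → (Fin n → ℕ) → ℕ
sumℕ {n} f = foldr N._+_ 0 (map f (allFin n))

sumℚ : ∀ {n} → (Fin n → ℚ) → ℚ
sumℚ {n} f = foldr _+_ 0ℚ (map f (allFin n))

b2n : Bool → ℕ
b2n true = 1
b2n false = 0

outdeg : ∀ {n} → Digraph n → Fin n → ℕ
outdeg G i = sumℕ (λ j → b2n (G i j))

indeg : ∀ {n} → Digraph n → Fin n → ℕ
indeg G i = sumℕ (λ j → b2n (G j i))

deg : ∀ {n} → Digraph n → Fin n → ℕ
deg G i = outdeg G i N.+ indeg G i

odd? : ℕ → Bool
odd? k = ⌊ k N.% 2 ≟ 1 ⌋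

fibWeight : ∀ {n} → Digraph n → Fin n → ℤ
fibWeight G i = if odd? (deg G i) then Z.- (+ fib (deg G i)) else + fib (deg G i)

-- d(v_i^h): maximum of d(v_j) over heads v_j of v_i (meaningful when d⁺(v_i) ≥ 1)
headDeg : ∀ {n} → Digraph n → Fin n → ℕ
headDeg {n} G i = foldr _⊔_ 0 (map (λ j → if G i j then deg G j else 0) (allFin n))

ℤtoℚ : ℤ → ℚ
ℤtoℚ z = z / 1

-- ∫_a^b (m x + c) dx = m (b² - a²)/2 + c (b - a)
integral : ℤ → ℤ → ℚ → ℚ → ℚ
integral m c a b = (ℤtoℚ m * (b * b - a * a)) * (+ 1 / 2) + ℤtoℚ c * (b - a)

irrK : ∀ {n} → ℤ → ℤ → Digraph n → ℚ
irrK m c G = sumℚ term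
  where
  term : _ → ℚ
  term i with outdeg G i
  ... | zero = 0ℚ
  ... | suc _ = Data.Rational.∣ integral m c (ℤtoℚ (fibWeight G i)) (ℤtoℚ (+ headDeg G i)) ∣
    where import Data.Rational

-- Directed cycle C_n with arcs (v_i, v_{i+1}) and (v_n, v_1) (0-indexed: i → (i+1) mod n)
cycleDigraph : (n : ℕ) → Digraph n
cycleDigraph n i j = ⌊ toℕ j ≟ suc (toℕ i) ⌋ ∨ (⌊ suc (toℕ i) ≟ n ⌋ ∧ ⌊ toℕ j ≟ 0 ⌋)

module Submission where

-- In C⃗ₙ every vertex has exactly one out-neighbour and one in-neighbour, so
-- every vertex has degree 2, ±Fibonacci weight f₂ = 1, and its (unique) head
-- also has degree 2.  Each vertex therefore contributes |∫₁² (mx + c) dx| =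
-- |3m/2 + c|, and there are n vertices.

open import Defs
open import Data.Nat using (ℕ; _≥_)
open import Data.Integer using (ℤ; +_)
open import Data.Rational using (ℚ; ∣_∣; _+_; _*_; _/_)
open import Relation.Binary.PropositionalEquality using (_≡_)

import Data.Nat as N
open N using (zero; suc; _≤_; _<_; _⊔_; z≤n)
import Data.Nat.Properties as NP
open NP using (_≟_)
open import Data.Fin using (Fin; toℕ) renaming (zero to fzero; suc to fsuc)
open import Data.Fin.Properties using (toℕ<n)
open import Data.Bool using (Bool; true; false; T; if_then_else_)
open import Data.Bool.Properties using (T-∨; T-∧)
open import Data.List using (foldr; map; allFin)
open import Data.List.Properties using (map-tabulate; map-cong)
open import Data.Unit using (tt)
open import Data.Empty using (⊥-elim)
open import Relation.Nullary using (¬_; Dec; yes; no)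
open import Data.Sum using (_⊎_; inj₁; inj₂)
open import Data.Product using (Σ; ∃; _×_; _,_; proj₁; proj₂)
open import Function using (id; _∘_)
open import Function.Bundles using (_⇔_; mk⇔; Equivalence)
open import Relation.Nullary.Decidable using (⌊_⌋; toWitness; fromWitness)
open import Relation.Binary.PropositionalEquality
  using (refl; sym; trans; cong; cong₂; subst; module ≡-Reasoning)
open import Data.Rational using (1ℚ; 0ℚ; toℚᵘ)
import Data.Rational.Properties as QP
import Data.Integer as Z
import Data.Integer.Properties as ZP
import Data.Rational.Unnormalised as U
import Data.Rational.Unnormalised.Properties as UP

open Equivalence using (to; from)

foldr-allFin-suc : ∀ {A : Set} (_∙_ : A → A → A) (e : A) {n} (f : Fin (suc n) → A) →
  foldr _∙_ e (map f (allFin (suc n))) ≡ f fzero ∙ foldr _∙_ e (map (f ∘ fsuc) (allFin n))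
foldr-allFin-suc _∙_ e f =
  cong (λ xs → f fzero ∙ foldr _∙_ e xs)
       (trans (map-tabulate fsuc f) (sym (map-tabulate id (f ∘ fsuc))))

sumℕ-suc : ∀ {n} (f : Fin (suc n) → ℕ) → sumℕ f ≡ f fzero N.+ sumℕ (f ∘ fsuc)
sumℕ-suc = foldr-allFin-suc N._+_ 0

sumℚ-suc : ∀ {n} (f : Fin (suc n) → ℚ) → sumℚ f ≡ f fzero + sumℚ (f ∘ fsuc)
sumℚ-suc = foldr-allFin-suc _+_ 0ℚ

count : ∀ {n} → (Fin n → Bool) → ℕ
count p = sumℕ (λ j → b2n (p j))

b2n-true : ∀ {b} → T b → b2n b ≡ 1
b2n-true {true} _ = refl

b2n-false : ∀ {b} → ¬ T b → b2n b ≡ 0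
b2n-false {false} _ = refl
b2n-false {true} ¬t = ⊥-elim (¬t tt)

count-none : ∀ {n} (p : Fin n → Bool) → (∀ j → ¬ T (p j)) → count p ≡ 0
count-none {zero} p none = refl
count-none {suc n} p none =
  trans (sumℕ-suc (b2n ∘ p))
        (cong₂ N._+_ (b2n-false (none fzero)) (count-none (p ∘ fsuc) (none ∘ fsuc)))

count-unique : ∀ {n} (p : Fin n → Bool) t → t < n →
  (∀ j → T (p j) ⇔ toℕ j ≡ t) → count p ≡ 1
count-unique {suc n} p zero _ exactly =
  trans (sumℕ-suc (b2n ∘ p))
        (cong₂ N._+_ (b2n-true (from (exactly fzero) refl))
                     (count-none (p ∘ fsuc) (λ j pj → NP.1+n≢0 (to (exactly (fsuc j)) pj))))
count-unique {suc n} p (suc t) (N.s≤s t<n) exactly =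
  trans (sumℕ-suc (b2n ∘ p))
        (cong₂ N._+_ (b2n-false (λ p0 → NP.0≢1+n (to (exactly fzero) p0)))
                     (count-unique (p ∘ fsuc) t t<n (λ j → mk⇔
                        (NP.suc-injective ∘ to (exactly (fsuc j)))
                        (from (exactly (fsuc j)) ∘ cong suc))))

count-pos⇒∃ : ∀ {n} (p : Fin n → Bool) → 1 ≤ count p → ∃ λ j → T (p j)
count-pos⇒∃ {suc n} p pos = split (p fzero) refl (subst (1 ≤_) (sumℕ-suc (b2n ∘ p)) pos)
  where
  split : ∀ b → p fzero ≡ b → 1 ≤ b2n b N.+ count (p ∘ fsuc) → ∃ λ j → T (p j)
  split true p0 _ = fzero , subst T (sym p0) tt
  split false _ pos′ with count-pos⇒∃ (p ∘ fsuc) pos′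
  ... | j , pj = fsuc j , pj

maxℕ : ∀ {n} → (Fin n → ℕ) → ℕ
maxℕ f = foldr _⊔_ 0 (map f (allFin _))

maxℕ-≤ : ∀ {n} (f : Fin n → ℕ) {b} → (∀ j → f j ≤ b) → maxℕ f ≤ b
maxℕ-≤ {zero} f bound = z≤n
maxℕ-≤ {suc n} f bound =
  subst (_≤ _) (sym (foldr-allFin-suc _⊔_ 0 f))
        (NP.⊔-lub (bound fzero) (maxℕ-≤ (f ∘ fsuc) (bound ∘ fsuc)))

≤-maxℕ : ∀ {n} (f : Fin n → ℕ) j → f j ≤ maxℕ f
≤-maxℕ f fzero = subst (f fzero ≤_) (sym (foldr-allFin-suc _⊔_ 0 f)) (NP.m≤m⊔n _ _)
≤-maxℕ f (fsuc j) =
  subst (f (fsuc j) ≤_) (sym (foldr-allFin-suc _⊔_ 0 f))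
        (NP.≤-trans (≤-maxℕ (f ∘ fsuc) j) (NP.m≤n⊔m (f fzero) _))

maxℕ-attained : ∀ {n} (f : Fin n → ℕ) {b} j → (∀ k → f k ≤ b) → f j ≡ b → maxℕ f ≡ b
maxℕ-attained f j bound fj≡b =
  NP.≤-antisym (maxℕ-≤ f bound) (subst (_≤ maxℕ f) fj≡b (≤-maxℕ f j))

sumℚ-cong : ∀ {n} {f g : Fin n → ℚ} → (∀ i → f i ≡ g i) → sumℚ f ≡ sumℚ g
sumℚ-cong {n} f≗g = cong (foldr _+_ 0ℚ) (map-cong f≗g (allFin n))

ℤtoℚ-suc : ∀ n → ℤtoℚ (+ suc n) ≡ 1ℚ + ℤtoℚ (+ n)
ℤtoℚ-suc n = QP.toℚᵘ-injective (begin
  toℚᵘ (ℤtoℚ (+ suc n))                   ≈⟨ QP.toℚᵘ-fromℚᵘ (U.mkℚᵘ (+ suc n) 0) ⟩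
  U.mkℚᵘ (+ suc n) 0                      ≈⟨ U.*≡* numerators ⟩
  U.1ℚᵘ U.+ U.mkℚᵘ (+ n) 0                ≈⟨ UP.+-congʳ U.1ℚᵘ (UP.≃-sym (QP.toℚᵘ-fromℚᵘ (U.mkℚᵘ (+ n) 0))) ⟩
  toℚᵘ 1ℚ U.+ toℚᵘ (ℤtoℚ (+ n))           ≈⟨ UP.≃-sym (QP.toℚᵘ-homo-+ 1ℚ (ℤtoℚ (+ n))) ⟩
  toℚᵘ (1ℚ + ℤtoℚ (+ n))                  ∎)
  where
  open UP.≃-Reasoning
  numerators : + suc n Z.* + 1 ≡ (+ 1 Z.+ + n Z.* + 1) Z.* + 1
  numerators = trans (ZP.*-identityʳ (+ suc n))
                     (sym (trans (ZP.*-identityʳ _) (cong (λ k → + 1 Z.+ k) (ZP.*-identityʳ (+ n)))))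

sumℚ-const : ∀ n (y : ℚ) → sumℚ {n} (λ _ → y) ≡ ℤtoℚ (+ n) * y
sumℚ-const zero y = sym (QP.*-zeroˡ y)
sumℚ-const (suc n) y = begin
  sumℚ {suc n} (λ _ → y)           ≡⟨ sumℚ-suc {n} (λ _ → y) ⟩
  y + sumℚ {n} (λ _ → y)           ≡⟨ cong₂ _+_ (sym (QP.*-identityˡ y)) (sumℚ-const n y) ⟩
  1ℚ * y + ℤtoℚ (+ n) * y          ≡⟨ sym (QP.*-distribʳ-+ y 1ℚ (ℤtoℚ (+ n))) ⟩
  (1ℚ + ℤtoℚ (+ n)) * y            ≡⟨ cong (_* y) (sym (ℤtoℚ-suc n)) ⟩
  ℤtoℚ (+ suc n) * y               ∎
  where open ≡-Reasoning

integral-1-2 : ∀ m c → integral m c 1ℚ (ℤtoℚ (+ 2)) ≡ (+ 3 / 2) * ℤtoℚ m + ℤtoℚ c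
integral-1-2 m c = begin
  ℤtoℚ m * ℤtoℚ (+ 3) * (+ 1 / 2) + ℤtoℚ c * 1ℚ  ≡⟨ cong₂ _+_ (QP.*-assoc (ℤtoℚ m) _ _) (QP.*-identityʳ (ℤtoℚ c)) ⟩
  ℤtoℚ m * (+ 3 / 2) + ℤtoℚ c                    ≡⟨ cong (_+ ℤtoℚ c) (QP.*-comm (ℤtoℚ m) _) ⟩
  (+ 3 / 2) * ℤtoℚ m + ℤtoℚ c                    ∎
  where open ≡-Reasoning

contribution : ∀ {n} → ℤ → ℤ → Digraph n → Fin n → ℚ
contribution m c G i = ∣ integral m c (ℤtoℚ (fibWeight G i)) (ℤtoℚ (+ headDeg G i)) ∣

-- If every vertex has an out-neighbour (so the case d⁺(vᵢ) = 0 of the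
-- definition never applies) and all vertices contribute the same amount y,
-- then irrK is n·y.
irrK-uniform : ∀ {n} m c (G : Digraph n) {y : ℚ} → (∀ i → 1 ≤ outdeg G i) →
  (∀ i → contribution m c G i ≡ y) → irrK m c G ≡ ℤtoℚ (+ n) * y
irrK-uniform {n} m c G {y} pos uniform =
  trans (proj₂ unfolded) (trans (sumℚ-cong termEq) (sumℚ-const n y))
  where
  unfolded : Σ (Fin n → ℚ) λ term → irrK m c G ≡ sumℚ term
  unfolded = _ , refl
  termEq : ∀ i → proj₁ unfolded i ≡ y
  termEq i with outdeg G i | pos i
  ... | suc _ | _ = uniform i

fibWeight-deg2 : ∀ {n} (G : Digraph n) i → deg G i ≡ 2 → fibWeight G i ≡ + 1
fibWeight-deg2 G i d≡2 rewrite d≡2 = refl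

headDeg-regular : ∀ {n} (G : Digraph n) {d} → (∀ j → deg G j ≡ d) →
  ∀ i j → T (G i j) → headDeg G i ≡ d
headDeg-regular G {d} regular i j arc =
  maxℕ-attained headOrZero j bounded (trans (if-true arc) (regular j))
  where
  headOrZero : Fin _ → ℕ
  headOrZero k = if G i k then deg G k else 0
  if-true : ∀ {b x y} → T b → (if b then x else y) ≡ x
  if-true {true} _ = refl
  if-≤ : ∀ b x → (if b then x else 0) ≤ x
  if-≤ true x = NP.≤-refl
  if-≤ false x = z≤n
  bounded : ∀ k → headOrZero k ≤ d
  bounded k = NP.≤-trans (if-≤ (G i k) (deg G k)) (NP.≤-reflexive (regular k))

irrK-1-regular : ∀ {n} m c (G : Digraph n) →
  (∀ i → outdeg G i ≡ 1) → (∀ i → indeg G i ≡ 1) →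
  irrK m c G ≡ ℤtoℚ (+ n) * ∣ (+ 3 / 2) * ℤtoℚ m + ℤtoℚ c ∣
irrK-1-regular {n} m c G out1 in1 = begin
  irrK m c G                                      ≡⟨ irrK-uniform m c G (NP.≤-reflexive ∘ sym ∘ out1) contribution≡ ⟩
  ℤtoℚ (+ n) * ∣ integral m c 1ℚ (ℤtoℚ (+ 2)) ∣  ≡⟨ cong (λ x → ℤtoℚ (+ n) * ∣ x ∣) (integral-1-2 m c) ⟩
  ℤtoℚ (+ n) * ∣ (+ 3 / 2) * ℤtoℚ m + ℤtoℚ c ∣  ∎
  where
  open ≡-Reasoning
  deg2 : ∀ i → deg G i ≡ 2
  deg2 i = cong₂ N._+_ (out1 i) (in1 i)
  contribution≡ : ∀ i → contribution m c G i ≡ ∣ integral m c 1ℚ (ℤtoℚ (+ 2)) ∣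
  contribution≡ i with count-pos⇒∃ (G i) (NP.≤-reflexive (sym (out1 i)))
  ... | j , arc = cong₂ (λ a b → ∣ integral m c (ℤtoℚ a) (ℤtoℚ (+ b)) ∣)
                        (fibWeight-deg2 G i (deg2 i)) (headDeg-regular G deg2 i j arc)

CycleStep : ℕ → ℕ → ℕ → Set
CycleStep n a b = b ≡ suc a ⊎ (suc a ≡ n × b ≡ 0)

cycle-arc : ∀ {n} (i j : Fin n) → T (cycleDigraph n i j) ⇔ CycleStep n (toℕ i) (toℕ j)
cycle-arc {n} i j = mk⇔ arc⇒ ⇒arc
  where
  next? : Dec (toℕ j ≡ suc (toℕ i))
  next? = toℕ j ≟ suc (toℕ i)
  last? : Dec (suc (toℕ i) ≡ n)
  last? = suc (toℕ i) ≟ n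
  first? : Dec (toℕ j ≡ 0)
  first? = toℕ j ≟ 0
  arc⇒ : T (cycleDigraph n i j) → CycleStep n (toℕ i) (toℕ j)
  arc⇒ arc with to (T-∨ {⌊ next? ⌋}) arc
  ... | inj₁ next = inj₁ (toWitness next)
  ... | inj₂ wrap with to (T-∧ {⌊ last? ⌋}) wrap
  ...   | last , first = inj₂ (toWitness last , toWitness first)
  ⇒arc : CycleStep n (toℕ i) (toℕ j) → T (cycleDigraph n i j)
  ⇒arc (inj₁ next) = from (T-∨ {⌊ next? ⌋}) (inj₁ (fromWitness next))
  ⇒arc (inj₂ (last , first)) =
    from (T-∨ {⌊ next? ⌋}) (inj₂ (from (T-∧ {⌊ last? ⌋}) (fromWitness last , fromWitness first)))

cycle-outdeg : ∀ n (i : Fin n) → outdeg (cycleDigraph n) i ≡ 1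
cycle-outdeg n i = by-position (suc (toℕ i) ≟ n)
  where
  by-position : Dec (suc (toℕ i) ≡ n) → outdeg (cycleDigraph n) i ≡ 1
  by-position (yes last) =
    count-unique (cycleDigraph n i) 0 (NP.≤-trans (N.s≤s z≤n) (toℕ<n i)) λ j →
    mk⇔ (λ arc → case-first j (to (cycle-arc i j) arc))
        (λ first → from (cycle-arc i j) (inj₂ (last , first)))
    where
    case-first : ∀ j → CycleStep n (toℕ i) (toℕ j) → toℕ j ≡ 0
    case-first j (inj₁ next) = ⊥-elim (NP.<⇒≢ (toℕ<n j) (trans next last))
    case-first j (inj₂ (_ , first)) = first
  by-position (no notLast) =
    count-unique (cycleDigraph n i) (suc (toℕ i)) (NP.≤∧≢⇒< (toℕ<n i) notLast) λ j →
    mk⇔ (λ arc → case-next j (to (cycle-arc i j) arc))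
        (λ next → from (cycle-arc i j) (inj₁ next))
    where
    case-next : ∀ j → CycleStep n (toℕ i) (toℕ j) → toℕ j ≡ suc (toℕ i)
    case-next j (inj₁ next) = next
    case-next j (inj₂ (last , _)) = ⊥-elim (notLast last)

cycle-indeg : ∀ n (i : Fin n) → indeg (cycleDigraph n) i ≡ 1
cycle-indeg (suc n) fzero =
  count-unique (λ j → cycleDigraph (suc n) j fzero) n (NP.n<1+n n) λ j →
  mk⇔ (λ arc → case-last j (to (cycle-arc j fzero) arc))
      (λ lastj → from (cycle-arc j fzero) (inj₂ (cong suc lastj , refl)))
  where
  case-last : ∀ j → CycleStep (suc n) (toℕ j) 0 → toℕ j ≡ n
  case-last j (inj₁ ())
  case-last j (inj₂ (last , _)) = NP.suc-injective last
cycle-indeg (suc n) (fsuc k) =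
  count-unique (λ j → cycleDigraph (suc n) j (fsuc k)) (toℕ k) (NP.m<n⇒m<1+n (toℕ<n k)) λ j →
  mk⇔ (λ arc → case-prev j (to (cycle-arc j (fsuc k)) arc))
      (λ prev → from (cycle-arc j (fsuc k)) (inj₁ (cong suc (sym prev))))
  where
  case-prev : ∀ j → CycleStep (suc n) (toℕ j) (suc (toℕ k)) → toℕ j ≡ toℕ k
  case-prev j (inj₁ next) = sym (NP.suc-injective next)
  case-prev j (inj₂ (_ , ()))

-- The theorem: C⃗ₙ is 1-in 1-out regular.
mainTheorem2 : (n : ℕ) → n ≥ 3 → (m c : ℤ) →
    irrK m c (cycleDigraph n) ≡ ℤtoℚ (+ n) * ∣ (+ 3 / 2) * ℤtoℚ m + ℤtoℚ c ∣
mainTheorem2 n _ m c = irrK-1-regular m c (cycleDigraph n) (cycle-outdeg n) (cycle-indeg n)
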